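{- $\cong_{\mathcal{CS}_2}\ \le_c\ \cong_{\mathcal{CM}_2}\ \le_c\ \cong_{\mathcal{CS}_3}\ \le_c\ \cong_{\mathcal{CM}_3}\ \le_c\ \cdots$; that is, for every $n\ge2$, $\cong_{\mathcal{CS}_n}\le_c\cong_{\mathcal{CM}_n}$ and $\cong_{\mathcal{CM}_n}\le_c\cong_{\mathcal{CS}_{n+1}}$.
   Context: $W_e$ denotes the $e$-th c.e. set. $\mathcal{CS}$ is the variety of commutative semigroups, $\mathcal{CM}$ the variety of commutative monoids (signature with identity constant). For $n\ge1$, $X_n=\{x_0,\dots,x_{n-1}\}$; for each variety fix a computable bijective coding of pairs of terms over $X_n$ (in that variety's signature) by natural numbers. $\mathcal V_n[e]$ ($\mathcal V\in\{\mathcal{CS},\mathcal{CM}\}$) is the term algebra over $X_n$ modulo the smallest congruence containing the pairs coded in $W_e$ and all instances of the laws of $\mathcal V$; $e\cong_{\mathcal V_n}i$ iff $\mathcal V_n[e]\cong\mathcal V_n[i]$. $E\le_c F$ means there is a total computable $h$ with $x\,E\,y\iff h(x)\,F\,h(y)$. -}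

module Defs where

open import Data.Nat using (ℕ; zero; suc; _+_; _∸_; _<?_)
open import Data.Fin using (Fin; fromℕ<)
open import Data.Maybe using (Maybe; just; nothing; _>>=_)
open import Data.Product using (_×_; _,_; proj₁; proj₂; Σ; ∃)
open import Data.Unit using (⊤)
open import Relation.Nullary using (yes; no)
open import Relation.Binary.PropositionalEquality using (_≡_)
open import Function.Bundles using (_⇔_)

unpair : ℕ → ℕ × ℕ
unpair zero = 0 , 0
unpair (suc k) with unpair k
... | zero  , b = suc b , 0
... | suc a , b = a , suc b

tri : ℕ → ℕ
tri zero    = 0
tri (suc d) = suc d + tri d

-- inverse of unpair
pair : ℕ → ℕ → ℕ
pair a b = tri (a + b) + b

-- A model of computation: unary partial recursive functions with
-- built-in pairing (Z, S, identity, the two unpairing projections,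
-- composition, pairing of results, primitive recursion on the first
-- component, and unbounded minimisation).

data Prog : Set where
  Z S I L R  : Prog
  comp       : Prog → Prog → Prog
  pr         : Prog → Prog → Prog
  rec        : Prog → Prog → Prog   -- rec p q <0,y> = p y ;
                                    -- rec p q <m+1,y> = q <m, <rec p q <m,y>, y>>
  mu         : Prog → Prog          -- mu p x = least y with p <y,x> = 0

-- fuel-indexed evaluation; a program halts on x with value v iff
-- eval f p x ≡ just v for some fuel f
mutual
  eval : ℕ → Prog → ℕ → Maybe ℕ
  eval zero    _          _ = nothing
  eval (suc f) Z          x = just 0
  eval (suc f) S          x = just (suc x)
  eval (suc f) I          x = just x
  eval (suc f) L          x = just (proj₁ (unpair x))
  eval (suc f) R          x = just (proj₂ (unpair x))
  eval (suc f) (comp p q) x = eval f q x >>= eval f p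
  eval (suc f) (pr p q)   x = eval f p x >>= prCont f q x
  eval (suc f) (rec p q)  x = recEval f p q (proj₁ (unpair x)) (proj₂ (unpair x))
  eval (suc f) (mu p)     x = muSearch f p x 0

  prCont : ℕ → Prog → ℕ → ℕ → Maybe ℕ
  prCont f q x a = eval f q x >>= λ b → just (pair a b)

  recEval : ℕ → Prog → Prog → ℕ → ℕ → Maybe ℕ
  recEval f p q zero    y = eval f p y
  recEval f p q (suc m) y = recEval f p q m y >>= recCont f q m y

  recCont : ℕ → Prog → ℕ → ℕ → ℕ → Maybe ℕ
  recCont f q m y r = eval f q (pair m (pair r y))

  muSearch : ℕ → Prog → ℕ → ℕ → Maybe ℕ
  muSearch zero    _ _ _ = nothing
  muSearch (suc f) p x y = eval f p (pair y x) >>= muCont f p x y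

  muCont : ℕ → Prog → ℕ → ℕ → ℕ → Maybe ℕ
  muCont f p x y zero    = just y
  muCont f p x y (suc _) = muSearch f p x (suc y)

-- Gödel numbering of programs (surjective), by fuel-bounded decoding
decProg : ℕ → ℕ → Prog
decProg zero    _ = Z
decProg (suc f) 0 = Z
decProg (suc f) 1 = S
decProg (suc f) 2 = I
decProg (suc f) 3 = L
decProg (suc f) 4 = R
decProg (suc f) (suc (suc (suc (suc (suc k))))) =
  pick (proj₁ (unpair k)) (proj₂ (unpair k))
  where
  pick : ℕ → ℕ → Prog
  pick 0 r = mu (decProg f r)
  pick 1 r = comp (decProg f (proj₁ (unpair r))) (decProg f (proj₂ (unpair r)))
  pick 2 r = pr   (decProg f (proj₁ (unpair r))) (decProg f (proj₂ (unpair r)))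
  pick _ r = rec  (decProg f (proj₁ (unpair r))) (decProg f (proj₂ (unpair r)))

prog : ℕ → Prog
prog e = decProg (suc e) e

_∈W_ : ℕ → ℕ → Set
x ∈W e = Σ ℕ λ fuel → Σ ℕ λ v → eval fuel (prog e) x ≡ just v

Computable : (ℕ → ℕ) → Set
Computable h = Σ ℕ λ e → ∀ x → Σ ℕ λ fuel → eval fuel (prog e) x ≡ just (h x)

_≤c_ : (ℕ → ℕ → Set) → (ℕ → ℕ → Set) → Set
E ≤c F = Σ (ℕ → ℕ) λ h → Computable h × (∀ x y → (E x y ⇔ F (h x) (h y)))

data Sig : Set where
  CS CM : Sig

infixl 7 _∙_
data Term : Sig → ℕ → Set where
  var : ∀ {s n} → Fin n → Term s n
  _∙_ : ∀ {s n} → Term s n → Term s n → Term s n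
  ε   : ∀ {n} → Term CM n

-- bijective coding ℕ → Term s n (for n ≥ 1), fuel-bounded:
-- CS: k < n ↦ x_k ; k ≥ n ↦ t_a ∙ t_b where (a , b) = unpair (k ∸ n)
-- CM: 0 ↦ ε ; k+1 ↦ as in CS applied to k
mutual
  decTerm : (s : Sig) (n : ℕ) → ℕ → ℕ → Maybe (Term s n)
  decTerm s  n zero    k       = nothing
  decTerm CS n (suc f) k       = decNonUnit CS n f k
  decTerm CM n (suc f) zero    = just ε
  decTerm CM n (suc f) (suc k) = decNonUnit CM n f k

  decNonUnit : (s : Sig) (n : ℕ) → ℕ → ℕ → Maybe (Term s n)
  decNonUnit s n f k with k <? n
  ... | yes p = just (var (fromℕ< p))
  ... | no _  = decTerm s n f (proj₁ (unpair (k ∸ n))) >>= decCont s n f (proj₂ (unpair (k ∸ n)))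

  decCont : (s : Sig) (n : ℕ) → ℕ → ℕ → Term s n → Maybe (Term s n)
  decCont s n f b t = decTerm s n f b >>= λ u → just (t ∙ u)

decodeTerm : (s : Sig) (n : ℕ) → ℕ → Maybe (Term s n)
decodeTerm s n k = decTerm s n (suc k) k

decodePair : (s : Sig) (n : ℕ) → ℕ → Maybe (Term s n × Term s n)
decodePair s n k =
  decodeTerm s n (proj₁ (unpair k)) >>= λ t →
  decodeTerm s n (proj₂ (unpair k)) >>= λ u → just (t , u)

data Cong (n e : ℕ) : (s : Sig) → Term s n → Term s n → Set where
  base   : ∀ {s t u} k → k ∈W e → decodePair s n k ≡ just (t , u) → Cong n e s t u
  refl   : ∀ {s t} → Cong n e s t t
  sym    : ∀ {s t u} → Cong n e s t u → Cong n e s u t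
  trans  : ∀ {s t u v} → Cong n e s t u → Cong n e s u v → Cong n e s t v
  ∙-cong : ∀ {s t t′ u u′} → Cong n e s t t′ → Cong n e s u u′ → Cong n e s (t ∙ u) (t′ ∙ u′)
  assoc  : ∀ {s} (t u v : Term s n) → Cong n e s ((t ∙ u) ∙ v) (t ∙ (u ∙ v))
  comm   : ∀ {s} (t u : Term s n) → Cong n e s (t ∙ u) (u ∙ t)
  identʳ : ∀ (t : Term CM n) → Cong n e CM (t ∙ ε) t

PresUnit : (s : Sig) (n : ℕ) → (Term s n → Term s n) → (Term s n → Term s n → Set) → Set
PresUnit CS n f _≈_ = ⊤
PresUnit CM n f _≈_ = f ε ≈ ε

-- isomorphism of the quotient algebras V_n[e] ≅ V_n[i], presented on
-- representatives: mutually inverse (up to the congruences) maps that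
-- respect the congruences and are homomorphisms
record Iso (s : Sig) (n e i : ℕ) : Set where
  field
    to       : Term s n → Term s n
    from     : Term s n → Term s n
    to-cong  : ∀ {t u} → Cong n e s t u → Cong n i s (to t) (to u)
    from-cong : ∀ {t u} → Cong n i s t u → Cong n e s (from t) (from u)
    to-hom   : ∀ t u → Cong n i s (to (t ∙ u)) (to t ∙ to u)
    to-unit  : PresUnit s n to (Cong n i s)
    from-to  : ∀ t → Cong n e s (from (to t)) t
    to-from  : ∀ t → Cong n i s (to (from t)) t

≅[_,_] : Sig → ℕ → ℕ → ℕ → Set
≅[ s , n ] e i = Iso s n e i

module Submission where

-- CS_n ≤c CM_n: W_e is replaced by its image under a computable injection from
-- codes of pairs of CS-terms to codes of the same pairs read as CM-terms.  The
-- monoid so presented is the semigroup with an identity adjoined, in which ε is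
-- alone in its class; hence a semigroup isomorphism extends to the monoids, and
-- deleting ε (strip) restricts a monoid isomorphism to the semigroups.
--
-- CM_n ≤c CS_{n+1}: ε becomes the new generator x₀, and the relations
-- x_i ∙ x₀ = x_i make it an identity.  A semigroup isomorphism sends x₀ to an
-- identity, hence to the class of x₀, so it is a monoid isomorphism.
--
-- In both cases the new index is obtained from e by plugging the program e into
-- a fixed program context, whose Gödel number is a computable function of e.

open import Data.Empty using (⊥-elim)
open import Data.Fin using (Fin; fromℕ<; toℕ)
open import Data.Fin.Properties using (toℕ<n; fromℕ<-toℕ)
open import Data.Maybe using (Maybe; just; nothing; _>>=_; map)
open import Data.Maybe.Properties using (just-injective; map-cong; map-id; map-∘)
import Data.Maybe.Relation.Binary.Pointwise as Pointwise
open Pointwise using (Pointwise; just; nothing; drop-just)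
open import Data.Nat
open import Data.Nat.GeneralisedArithmetic using (fold; iterate; iterate-is-fold)
open import Data.Nat.Properties
open import Data.Product as Product using (_×_; _,_; proj₁; proj₂; Σ-syntax)
open import Data.Product.Properties using (,-injective)
open import Data.Sum using (_⊎_; inj₁; inj₂)
open import Data.Unit using (tt)
open import Function using (_∘_; id; const; _⇔_; mk⇔; Equivalence)
open import Function.Properties.Equivalence using (⇔-setoid)
open import Level using (0ℓ)
open import Relation.Binary.Bundles using (Setoid)
open import Relation.Binary.PropositionalEquality
import Relation.Binary.Reasoning.Setoid as SetoidReasoning
open import Relation.Nullary using (¬_; yes; no)

open import Defs renaming (refl to ≈-refl; sym to ≈-sym; trans to ≈-trans)

private
  variable
    a b c p q : Prog
    g g′ ga gb gc : ℕ → ℕ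
    x : ℕ

unpair₁ unpair₂ : ℕ → ℕ
unpair₁ k = proj₁ (unpair k)
unpair₂ k = proj₂ (unpair k)

unpair-suc-zero : ∀ k {b} → unpair k ≡ (0 , b) → unpair (suc k) ≡ (suc b , 0)
unpair-suc-zero k eq rewrite eq = refl

unpair-suc-suc : ∀ k {a b} → unpair k ≡ (suc a , b) → unpair (suc k) ≡ (a , suc b)
unpair-suc-suc k eq rewrite eq = refl

unpair-tri+ : ∀ d b → b ≤ d → unpair (tri d + b) ≡ (d ∸ b , b)
unpair-tri+ zero    zero    z≤n = refl
unpair-tri+ (suc d) zero    z≤n = begin
  unpair (tri (suc d) + 0)  ≡⟨ cong (unpair ∘ suc) (trans (+-identityʳ (d + tri d)) (+-comm d (tri d))) ⟩
  unpair (suc (tri d + d))  ≡⟨ unpair-suc-zero (tri d + d)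
                                 (trans (unpair-tri+ d d ≤-refl) (cong (_, d) (n∸n≡0 d))) ⟩
  (suc d , 0)               ∎
  where open ≡-Reasoning
unpair-tri+ (suc d) (suc b) (s≤s b≤d) = begin
  unpair (tri (suc d) + suc b)    ≡⟨ cong unpair (+-suc (tri (suc d)) b) ⟩
  unpair (suc (tri (suc d) + b))  ≡⟨ unpair-suc-suc (tri (suc d) + b)
                                       (trans (unpair-tri+ (suc d) b (m≤n⇒m≤1+n b≤d)) (cong (_, b) (+-∸-assoc 1 b≤d))) ⟩
  (d ∸ b , suc b)                 ∎
  where open ≡-Reasoning

unpair-pair : ∀ a b → unpair (pair a b) ≡ (a , b)
unpair-pair a b rewrite unpair-tri+ (a + b) b (m≤n+m b a) | m+n∸n≡m a b = refl

unpair₁-pair : ∀ a b → unpair₁ (pair a b) ≡ a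
unpair₁-pair a b = cong proj₁ (unpair-pair a b)

unpair₂-pair : ∀ a b → unpair₂ (pair a b) ≡ b
unpair₂-pair a b = cong proj₂ (unpair-pair a b)

unpair₁₂-pair : ∀ a b c → unpair₁ (unpair₂ (pair a (pair b c))) ≡ b
unpair₁₂-pair a b c = trans (cong unpair₁ (unpair₂-pair a (pair b c))) (unpair₁-pair b c)

unpair₂₂-pair : ∀ a b c → unpair₂ (unpair₂ (pair a (pair b c))) ≡ c
unpair₂₂-pair a b c = trans (cong unpair₂ (unpair₂-pair a (pair b c))) (unpair₂-pair b c)

pair-injective : ∀ {a b c d} → pair a b ≡ pair c d → a ≡ c × b ≡ d
pair-injective {a} {b} {c} {d} eq =
  ,-injective (trans (sym (unpair-pair a b)) (trans (cong unpair eq) (unpair-pair c d)))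

pair-unpair : ∀ k → pair (unpair₁ k) (unpair₂ k) ≡ k
pair-unpair zero = refl
pair-unpair (suc k) with unpair k | pair-unpair k
... | zero  , b | eq rewrite +-identityʳ b | +-identityʳ (tri (suc b)) | +-comm b (tri b) = cong suc eq
... | suc a , b | eq rewrite +-suc (tri (a + suc b)) b | +-suc a b = cong suc eq

unpair-injective : ∀ {k k'} → unpair₁ k ≡ unpair₁ k' → unpair₂ k ≡ unpair₂ k' → k ≡ k'
unpair-injective {k} {k'} eq₁ eq₂ = trans (sym (pair-unpair k)) (trans (cong₂ pair eq₁ eq₂) (pair-unpair k'))

unpair-sum≤ : ∀ k → unpair₁ k + unpair₂ k ≤ k
unpair-sum≤ zero = z≤n
unpair-sum≤ (suc k) with unpair k | unpair-sum≤ k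
... | zero  , b | le = s≤s (≤-trans (≤-reflexive (+-identityʳ b)) le)
... | suc a , b | le = ≤-trans (≤-reflexive (+-suc a b)) (m≤n⇒m≤1+n le)

unpair₁≤ : ∀ k → unpair₁ k ≤ k
unpair₁≤ k = ≤-trans (m≤m+n _ _) (unpair-sum≤ k)

unpair₂≤ : ∀ k → unpair₂ k ≤ k
unpair₂≤ k = ≤-trans (m≤n+m _ _) (unpair-sum≤ k)

unpair₁-∸< : ∀ {m k} → 1 ≤ m → m ≤ k → unpair₁ (k ∸ m) < k
unpair₁-∸< {m} {k} 1≤m m≤k = ≤-<-trans (unpair₁≤ (k ∸ m)) (∸-monoʳ-< {k} {m} {0} 1≤m m≤k)

unpair₂-∸< : ∀ {m k} → 1 ≤ m → m ≤ k → unpair₂ (k ∸ m) < k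
unpair₂-∸< {m} {k} 1≤m m≤k = ≤-<-trans (unpair₂≤ (k ∸ m)) (∸-monoʳ-< {k} {m} {0} 1≤m m≤k)

≤-pairˡ : ∀ a b → a ≤ pair a b
≤-pairˡ a b = subst (_≤ pair a b) (unpair₁-pair a b) (unpair₁≤ (pair a b))

≤-pairʳ : ∀ a b → b ≤ pair a b
≤-pairʳ a b = subst (_≤ pair a b) (unpair₂-pair a b) (unpair₂≤ (pair a b))

>>=-just-inv : ∀ {A B : Set} (m : Maybe A) (k : A → Maybe B) {v} → (m >>= k) ≡ just v →
  Σ[ a ∈ A ] m ≡ just a × k a ≡ just v
>>=-just-inv (just a) k eq = a , refl , eq

mutual
  eval-mono : ∀ {f f'} → f ≤ f' → ∀ p x {v} → eval f p x ≡ just v → eval f' p x ≡ just v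
  eval-mono {suc f} {suc f'} (s≤s le) Z x eq = eq
  eval-mono {suc f} {suc f'} (s≤s le) S x eq = eq
  eval-mono {suc f} {suc f'} (s≤s le) I x eq = eq
  eval-mono {suc f} {suc f'} (s≤s le) L x eq = eq
  eval-mono {suc f} {suc f'} (s≤s le) R x eq = eq
  eval-mono {suc f} {suc f'} (s≤s le) (comp p q) x eq with >>=-just-inv (eval f q x) (eval f p) eq
  ... | a , eq₁ , eq₂ rewrite eval-mono le q x eq₁ = eval-mono le p a eq₂
  eval-mono {suc f} {suc f'} (s≤s le) (pr p q) x eq with >>=-just-inv (eval f p x) (prCont f q x) eq
  ... | a , eq₁ , eq₂ rewrite eval-mono le p x eq₁ = prCont-mono le q x a eq₂
  eval-mono {suc f} {suc f'} (s≤s le) (rec p q) x eq = recEval-mono le p q (unpair₁ x) (unpair₂ x) eq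
  eval-mono {suc f} {suc f'} (s≤s le) (mu p) x eq = muSearch-mono le p x 0 eq

  prCont-mono : ∀ {f f'} → f ≤ f' → ∀ q x a {v} →
    prCont f q x a ≡ just v → prCont f' q x a ≡ just v
  prCont-mono {f} le q x a eq with >>=-just-inv (eval f q x) _ eq
  ... | b , eq₁ , eq₂ rewrite eval-mono le q x eq₁ = eq₂

  recEval-mono : ∀ {f f'} → f ≤ f' → ∀ p q m y {v} →
    recEval f p q m y ≡ just v → recEval f' p q m y ≡ just v
  recEval-mono le p q zero y eq = eval-mono le p y eq
  recEval-mono {f} le p q (suc m) y eq with >>=-just-inv (recEval f p q m y) (recCont f q m y) eq
  ... | r , eq₁ , eq₂ rewrite recEval-mono le p q m y eq₁ = eval-mono le q _ eq₂

  muSearch-mono : ∀ {f f'} → f ≤ f' → ∀ p x y {v} →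
    muSearch f p x y ≡ just v → muSearch f' p x y ≡ just v
  muSearch-mono {suc f} {suc f'} (s≤s le) p x y eq with >>=-just-inv (eval f p (pair y x)) (muCont f p x y) eq
  ... | r , eq₁ , eq₂ rewrite eval-mono le p (pair y x) eq₁ = muCont-mono le p x y r eq₂

  muCont-mono : ∀ {f f'} → f ≤ f' → ∀ p x y r {v} →
    muCont f p x y r ≡ just v → muCont f' p x y r ≡ just v
  muCont-mono le p x y zero    eq = eq
  muCont-mono le p x y (suc r) eq = muSearch-mono le p x (suc y) eq

eval-deterministic : ∀ {f f'} p x {v w} → eval f p x ≡ just v → eval f' p x ≡ just w → v ≡ w
eval-deterministic {f} {f'} p x eq eq' =
  just-injective (trans (sym (eval-mono (m≤m⊔n f f') p x eq)) (eval-mono (m≤n⊔m f f') p x eq'))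

Computes : Prog → (ℕ → ℕ) → Set
Computes p g = ∀ x → Σ[ f ∈ ℕ ] eval f p x ≡ just (g x)

computes-≗ : Computes p g → g ≗ g′ → Computes p g′
computes-≗ cp g≗g′ x with cp x
... | f , eq = f , trans eq (cong just (g≗g′ x))

computes-value : Computes p g → ∀ f x {v} → eval f p x ≡ just v → v ≡ g x
computes-value {p} cp f x eq = eval-deterministic {f} {proj₁ (cp x)} p x eq (proj₂ (cp x))

Z-computes : Computes Z (const 0)
Z-computes x = 1 , refl

S-computes : Computes S suc
S-computes x = 1 , refl

I-computes : Computes I id
I-computes x = 1 , refl

L-computes : Computes L unpair₁
L-computes x = 1 , refl

R-computes : Computes R unpair₂
R-computes x = 1 , refl

comp-computes : Computes p g → Computes q g′ → Computes (comp p q) (g ∘ g′)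
comp-computes {p} {g} {q} {g′} cp cq x with cq x | cp (g′ x)
... | f₁ , eq₁ | f₂ , eq₂ = suc (f₁ ⊔ f₂) , eq
  where
  eq : (eval (f₁ ⊔ f₂) q x >>= eval (f₁ ⊔ f₂) p) ≡ just (g (g′ x))
  eq rewrite eval-mono (m≤m⊔n f₁ f₂) q x eq₁ = eval-mono (m≤n⊔m f₁ f₂) p (g′ x) eq₂

pr-computes : Computes p g → Computes q g′ → Computes (pr p q) (λ x → pair (g x) (g′ x))
pr-computes {p} {g} {q} {g′} cp cq x with cp x | cq x
... | f₁ , eq₁ | f₂ , eq₂ = suc (f₁ ⊔ f₂) , eq
  where
  eq : (eval (f₁ ⊔ f₂) p x >>= prCont (f₁ ⊔ f₂) q x) ≡ just (pair (g x) (g′ x))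
  eq rewrite eval-mono (m≤m⊔n f₁ f₂) p x eq₁ | eval-mono (m≤n⊔m f₁ f₂) q x eq₂ = refl

primrec : (ℕ → ℕ) → (ℕ → ℕ) → ℕ → ℕ → ℕ
primrec z s zero    y = z y
primrec z s (suc m) y = s (pair m (pair (primrec z s m y) y))

recEval-computes : Computes p g → Computes q g′ →
  ∀ m y → Σ[ f ∈ ℕ ] recEval f p q m y ≡ just (primrec g g′ m y)
recEval-computes cp cq zero y = cp y
recEval-computes {p} {g} {q} {g′} cp cq (suc m) y
  with recEval-computes cp cq m y | cq (pair m (pair (primrec g g′ m y) y))
... | f₁ , eq₁ | f₂ , eq₂ = f₁ ⊔ f₂ , eq
  where
  eq : (recEval (f₁ ⊔ f₂) p q m y >>= recCont (f₁ ⊔ f₂) q m y) ≡ just (primrec g g′ (suc m) y)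
  eq rewrite recEval-mono (m≤m⊔n f₁ f₂) p q m y eq₁ = eval-mono (m≤n⊔m f₁ f₂) q _ eq₂

rec-computes : Computes p g → Computes q g′ →
  Computes (rec p q) (λ x → primrec g g′ (unpair₁ x) (unpair₂ x))
rec-computes cp cq x with recEval-computes cp cq (unpair₁ x) (unpair₂ x)
... | f , eq = suc f , eq

muSearch-complete : Computes p g → ∀ x y d → g (pair (d + y) x) ≡ 0 →
  (∀ k → k < d → g (pair (k + y) x) ≢ 0) → Σ[ f ∈ ℕ ] muSearch f p x y ≡ just (d + y)
muSearch-complete {p} {g} cp x y zero g≡0 _ with cp (pair y x)
... | f , eq = suc f , search
  where
  search : (eval f p (pair y x) >>= muCont f p x y) ≡ just y
  search rewrite eq | g≡0 = refl
muSearch-complete {p} {g} cp x y (suc d) g≡0 g≢0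
  with cp (pair y x)
     | muSearch-complete cp x (suc y) d (subst (λ z → g (pair z x) ≡ 0) (sym (+-suc d y)) g≡0)
         (λ k k<d → g≢0 (suc k) (s≤s k<d) ∘ subst (λ z → g (pair z x) ≡ 0) (+-suc k y))
... | f₁ , eq₁ | f₂ , eq₂ = suc (f₁ ⊔ f₂) , search
  where
  search : (eval (f₁ ⊔ f₂) p (pair y x) >>= muCont (f₁ ⊔ f₂) p x y) ≡ just (suc d + y)
  search rewrite eval-mono (m≤m⊔n f₁ f₂) p (pair y x) eq₁ with g (pair y x) | g≢0 0 (s≤s z≤n)
  ... | zero  | g≢0₀ = ⊥-elim (g≢0₀ refl)
  ... | suc _ | _    = trans (muSearch-mono (m≤n⊔m f₁ f₂) p x (suc y) eq₂) (cong just (+-suc d y))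

mu-complete : Computes p g → ∀ x v → g (pair v x) ≡ 0 → (∀ u → u < v → g (pair u x) ≢ 0) →
  Σ[ f ∈ ℕ ] eval f (mu p) x ≡ just v
mu-complete {p} {g} cp x v g≡0 g≢0
  with muSearch-complete cp x 0 v (subst (λ z → g (pair z x) ≡ 0) (sym (+-identityʳ v)) g≡0)
         (λ u u<v → g≢0 u u<v ∘ subst (λ z → g (pair z x) ≡ 0) (+-identityʳ u))
... | f , eq = suc f , trans eq (cong just (+-identityʳ v))

muSearch-sound : Computes p g → ∀ f x y {v} → muSearch f p x y ≡ just v → g (pair v x) ≡ 0
muSearch-sound {p} {g} cp (suc f) x y eq with >>=-just-inv (eval f p (pair y x)) (muCont f p x y) eq
... | zero  , eq₁ , refl = sym (computes-value cp f (pair y x) eq₁)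
... | suc _ , _   , eq₂  = muSearch-sound cp f x (suc y) eq₂

mu-sound : Computes p g → ∀ f x {v} → eval f (mu p) x ≡ just v → g (pair v x) ≡ 0
mu-sound cp (suc f) x eq = muSearch-sound cp f x 0 eq

binP : Prog → Prog → Prog → Prog
binP op p q = comp op (pr p q)

binP-computes : ∀ {op} (_⊕_ : ℕ → ℕ → ℕ) → Computes op (λ x → unpair₁ x ⊕ unpair₂ x) →
  Computes p g → Computes q g′ → Computes (binP op p q) (λ x → g x ⊕ g′ x)
binP-computes {g = g} {g′ = g′} _⊕_ cop cp cq = computes-≗ (comp-computes cop (pr-computes cp cq))
  λ x → cong₂ _⊕_ (unpair₁-pair (g x) (g′ x)) (unpair₂-pair (g x) (g′ x))

addConstP : ℕ → Prog → Prog
addConstP zero    p = p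
addConstP (suc k) p = comp S (addConstP k p)

addConstP-computes : ∀ k → Computes p g → Computes (addConstP k p) (λ x → k + g x)
addConstP-computes zero    cp = cp
addConstP-computes (suc k) cp = comp-computes S-computes (addConstP-computes k cp)

constP : ℕ → Prog
constP k = addConstP k Z

constP-computes : ∀ k → Computes (constP k) (const k)
constP-computes k = computes-≗ (addConstP-computes k Z-computes) (λ _ → +-identityʳ k)

foldP : Prog → Prog
foldP p = rec I (comp p (comp L R))

foldP-computes : ∀ {s} → Computes p s → Computes (foldP p) (λ x → fold (unpair₂ x) s (unpair₁ x))
foldP-computes {s = s} cp =
  computes-≗ (rec-computes I-computes (comp-computes cp (comp-computes L-computes R-computes)))
    λ x → primrec-fold (unpair₁ x) (unpair₂ x)
  where
  primrec-fold : ∀ m y → primrec id (s ∘ unpair₁ ∘ unpair₂) m y ≡ fold y s m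
  primrec-fold zero    y = refl
  primrec-fold (suc m) y = cong s (trans (unpair₁₂-pair m _ y) (primrec-fold m y))

rec₀ : Prog → Prog → Prog
rec₀ p q = comp (rec p q) (pr I Z)

rec₀-computes : Computes p g → Computes q g′ → Computes (rec₀ p q) (λ x → primrec g g′ x 0)
rec₀-computes {g = g} {g′ = g′} cp cq =
  computes-≗ (comp-computes (rec-computes cp cq) (pr-computes I-computes Z-computes))
    λ x → cong₂ (primrec g g′) (unpair₁-pair x 0) (unpair₂-pair x 0)

predP : Prog
predP = rec₀ Z L

predP-computes : Computes predP pred
predP-computes = computes-≗ (rec₀-computes Z-computes L-computes) primrec-pred
  where
  primrec-pred : ∀ x → primrec (const 0) unpair₁ x 0 ≡ pred x
  primrec-pred zero    = refl
  primrec-pred (suc x) = unpair₁-pair x _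

subP : Prog
subP = binP (foldP predP) R L

subP-computes : Computes subP (λ x → unpair₁ x ∸ unpair₂ x)
subP-computes =
  computes-≗ (binP-computes (λ m y → fold y pred m) (foldP-computes predP-computes) R-computes L-computes)
    λ x → fold-pred (unpair₁ x) (unpair₂ x)
  where
  fold-pred : ∀ y m → fold y pred m ≡ y ∸ m
  fold-pred y zero    = refl
  fold-pred y (suc m) = trans (cong pred (fold-pred y m)) (pred[m∸n]≡m∸[1+n] y m)

addP : Prog
addP = foldP S

addP-computes : Computes addP (λ x → unpair₁ x + unpair₂ x)
addP-computes = computes-≗ (foldP-computes S-computes) λ x → fold-suc (unpair₂ x) (unpair₁ x)
  where
  fold-suc : ∀ y m → fold y suc m ≡ m + y
  fold-suc y zero    = refl
  fold-suc y (suc m) = cong suc (fold-suc y m)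

∣m-n∣≡m∸n+n∸m : ∀ m n → ∣ m - n ∣ ≡ (m ∸ n) + (n ∸ m)
∣m-n∣≡m∸n+n∸m zero    zero    = refl
∣m-n∣≡m∸n+n∸m zero    (suc n) = refl
∣m-n∣≡m∸n+n∸m (suc m) zero    = sym (+-identityʳ (suc m))
∣m-n∣≡m∸n+n∸m (suc m) (suc n) = ∣m-n∣≡m∸n+n∸m m n

distP : Prog
distP = binP addP subP (binP subP R L)

distP-computes : Computes distP (λ x → ∣ unpair₁ x - unpair₂ x ∣)
distP-computes =
  computes-≗ (binP-computes _+_ addP-computes subP-computes (binP-computes _∸_ subP-computes R-computes L-computes))
    λ x → sym (∣m-n∣≡m∸n+n∸m (unpair₁ x) (unpair₂ x))

iterateP : Prog
iterateP = foldP R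

iterateP-computes : Computes iterateP (λ x → iterate unpair₂ (unpair₂ x) (unpair₁ x))
iterateP-computes =
  computes-≗ (foldP-computes R-computes) λ x → iterate-is-fold (unpair₂ x) unpair₂ (unpair₁ x)

sign : ℕ → ℕ
sign zero    = 0
sign (suc _) = 1

signP : Prog
signP = rec₀ Z (constP 1)

signP-computes : Computes signP sign
signP-computes = computes-≗ (rec₀-computes Z-computes (constP-computes 1)) primrec-sign
  where
  primrec-sign : ∀ x → primrec (const 0) (const 1) x 0 ≡ sign x
  primrec-sign zero    = refl
  primrec-sign (suc x) = refl

ifz : ℕ → ℕ → ℕ → ℕ
ifz zero    a b = a
ifz (suc _) a b = b

-- Recursing on sign (c x) rather than c x means b runs at most once.
ifzP : Prog → Prog → Prog → Prog
ifzP c a b = binP (rec a (comp b (comp R R))) (comp signP c) I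

ifzP-computes : Computes c gc → Computes a ga → Computes b gb →
  Computes (ifzP c a b) (λ x → ifz (gc x) (ga x) (gb x))
ifzP-computes {gc = gc} {ga = ga} {gb = gb} cc ca cb =
  computes-≗ (binP-computes (primrec ga (gb ∘ unpair₂ ∘ unpair₂))
                            (rec-computes ca (comp-computes cb (comp-computes R-computes R-computes)))
                            (comp-computes signP-computes cc) I-computes)
    λ x → primrec-sign (gc x) x
  where
  primrec-sign : ∀ m x → primrec ga (gb ∘ unpair₂ ∘ unpair₂) (sign m) x ≡ ifz m (ga x) (gb x)
  primrec-sign zero    x = refl
  primrec-sign (suc _) x = cong gb (unpair₂₂-pair 0 (ga x) x)

eval-rec : ∀ f m y → eval (suc f) (rec p q) (pair m y) ≡ recEval f p q m y
eval-rec {p} {q} f m y = cong₂ (recEval f p q) (unpair₁-pair m y) (unpair₂-pair m y)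

Halts : Prog → ℕ → Set
Halts p x = Σ[ f ∈ ℕ ] Σ[ v ∈ ℕ ] eval f p x ≡ just v

comp-halts⁻ : ∀ x → Halts (comp p q) x → Σ[ f ∈ ℕ ] Σ[ y ∈ ℕ ] eval f q x ≡ just y × Halts p y
comp-halts⁻ {p} {q} x (suc f , v , eq) with >>=-just-inv (eval f q x) (eval f p) eq
... | y , eq₁ , eq₂ = f , y , eq₁ , f , v , eq₂

comp-halts⁺ : ∀ {f x y} → eval f q x ≡ just y → Halts p y → Halts (comp p q) x
comp-halts⁺ {q} {p} {f} {x} {y} eq (f' , v , eq') = suc (f ⊔ f') , v , run
  where
  run : (eval (f ⊔ f') q x >>= eval (f ⊔ f') p) ≡ just v
  run rewrite eval-mono (m≤m⊔n f f') q x eq = eval-mono (m≤n⊔m f f') p y eq'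

comp-halts : Computes q g′ → ∀ x → Halts (comp p q) x ⇔ Halts p (g′ x)
comp-halts {q} {g′} {p} cq x = mk⇔ to (comp-halts⁺ {f = proj₁ (cq x)} (proj₂ (cq x)))
  where
  to : Halts (comp p q) x → Halts p (g′ x)
  to hlt with comp-halts⁻ x hlt
  ... | f , y , eq , hlt' rewrite computes-value cq f x eq = hlt'

rec-halts-zero : Computes p g → ∀ x → Halts (rec p q) (pair 0 x)
rec-halts-zero {g = g} cp x with cp x
... | f , eq = suc f , g x , trans (eval-rec f 0 x) eq

rec-halts-one : Computes p g → ∀ x → Halts (rec p q) (pair 1 x) ⇔ Halts q (pair 0 (pair (g x) x))
rec-halts-one {p} {g} {q} cp x = mk⇔ to from
  where
  to : Halts (rec p q) (pair 1 x) → Halts q (pair 0 (pair (g x) x))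
  to (suc f , v , eq) with >>=-just-inv (eval f p x) (recCont f q 0 x) (trans (sym (eval-rec f 1 x)) eq)
  ... | y , eq₁ , eq₂ rewrite computes-value cp f x eq₁ = f , v , eq₂
  from : Halts q (pair 0 (pair (g x) x)) → Halts (rec p q) (pair 1 x)
  from (f , v , eq) with cp x
  ... | f' , eq' = suc (f' ⊔ f) , v , trans (eval-rec (f' ⊔ f) 1 x) run
    where
    run : (eval (f' ⊔ f) p x >>= recCont (f' ⊔ f) q 0 x) ≡ just v
    run rewrite eval-mono (m≤m⊔n f' f) p x eq' = eval-mono (m≤n⊔m f' f) q _ eq

ifzP-halts : Computes c gc → ∀ x →
  Halts (ifzP c a b) x ⇔ Halts (rec a (comp b (comp R R))) (pair (sign (gc x)) x)
ifzP-halts cc = comp-halts (pr-computes (comp-computes signP-computes cc) I-computes)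

ifzP-halts-zero : Computes c gc → Computes a ga → gc x ≡ 0 → Halts (ifzP c a b) x
ifzP-halts-zero {x = x} cc ca gc≡0 =
  Equivalence.from (ifzP-halts cc x) (subst (λ m → Halts _ (pair (sign m) x)) (sym gc≡0) (rec-halts-zero ca x))

ifzP-halts-suc : Computes c gc → Computes a ga → gc x ≢ 0 → Halts (ifzP c a b) x ⇔ Halts b x
ifzP-halts-suc {c} {gc} {a} {ga} {x} {b} cc ca gc≢0 = begin
  Halts (ifzP c a b) x                                  ≈⟨ ifzP-halts cc x ⟩
  Halts (rec a B) (pair (sign (gc x)) x)                ≡⟨ cong (λ m → Halts (rec a B) (pair m x)) (sign≢0 (gc x) gc≢0) ⟩
  Halts (rec a B) (pair 1 x)                            ≈⟨ rec-halts-one ca x ⟩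
  Halts B (pair 0 (pair (ga x) x))                      ≈⟨ comp-halts (comp-computes R-computes R-computes) _ ⟩
  Halts b (unpair₂ (unpair₂ (pair 0 (pair (ga x) x))))  ≡⟨ cong (Halts b) (unpair₂₂-pair 0 (ga x) x) ⟩
  Halts b x                                             ∎
  where
  open SetoidReasoning (⇔-setoid 0ℓ)
  B = comp b (comp R R)
  sign≢0 : ∀ m → m ≢ 0 → sign m ≡ 1
  sign≢0 zero    m≢0 = ⊥-elim (m≢0 refl)
  sign≢0 (suc _) _   = refl

-- Course-of-values recursion

history : (ℕ → ℕ → ℕ) → ℕ → ℕ
history step zero    = 0
history step (suc m) = pair (step m (history step m)) (history step m)

-- In history step m, the value at i < m lies below m ∸ suc i outer pairs.
lookupHistory : ℕ → ℕ → ℕ → ℕ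
lookupHistory i m hist = unpair₁ (iterate unpair₂ hist (m ∸ suc i))

iterate-history : ∀ step d k → iterate unpair₂ (history step (d + k)) d ≡ history step k
iterate-history step zero    k = refl
iterate-history step (suc d) k =
  trans (cong (λ hist → iterate unpair₂ hist d) (unpair₂-pair (step (d + k) (history step (d + k))) (history step (d + k))))
        (iterate-history step d k)

lookupHistory-history : ∀ step {i m} → i < m → lookupHistory i m (history step m) ≡ step i (history step i)
lookupHistory-history step {i} {m} i<m = begin
  unpair₁ (iterate unpair₂ (history step m) d)              ≡⟨ cong (λ k → unpair₁ (iterate unpair₂ (history step k) d))
                                                                    (sym (m∸n+n≡m i<m)) ⟩
  unpair₁ (iterate unpair₂ (history step (d + suc i)) d)    ≡⟨ cong unpair₁ (iterate-history step d (suc i)) ⟩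
  unpair₁ (history step (suc i))                            ≡⟨ unpair₁-pair _ (history step i) ⟩
  step i (history step i)                                   ∎
  where
  open ≡-Reasoning
  d = m ∸ suc i

historyP : Prog → Prog
historyP p = rec₀ Z (binP (pr p R) L (comp L R))

historyP-computes : ∀ {p step} → Computes p (λ w → step (unpair₁ w) (unpair₂ w)) →
  Computes (historyP p) (history step)
historyP-computes {p} {step} cp =
  computes-≗ (rec₀-computes Z-computes
               (binP-computes (λ a b → pair (step a b) b) (pr-computes cp R-computes)
                              L-computes (comp-computes L-computes R-computes)))
    primrec-history
  where
  extend : ℕ → ℕ
  extend z = pair (step (unpair₁ z) (unpair₁ (unpair₂ z))) (unpair₁ (unpair₂ z))

  primrec-history : ∀ m → primrec (const 0) extend m 0 ≡ history step m
  primrec-history zero    = refl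
  primrec-history (suc m) = cong₂ (λ a b → pair (step a b) b) (unpair₁-pair m _)
                                  (trans (unpair₁₂-pair m _ 0) (primrec-history m))

courseOfValuesP : Prog → Prog
courseOfValuesP p = binP p I (historyP p)

courseOfValuesP-computes : ∀ {p step} → Computes p (λ w → step (unpair₁ w) (unpair₂ w)) →
  Computes (courseOfValuesP p) (λ m → step m (history step m))
courseOfValuesP-computes {step = step} cp = binP-computes step cp I-computes (historyP-computes cp)

lookupP : Prog → Prog
lookupP ip = comp L (binP iterateP (binP subP L (comp S ip)) R)

lookupP-computes : ∀ {ip gi} → Computes ip gi →
  Computes (lookupP ip) (λ w → lookupHistory (gi w) (unpair₁ w) (unpair₂ w))
lookupP-computes ci =
  comp-computes L-computes
    (binP-computes (λ d hist → iterate unpair₂ hist d) iterateP-computes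
      (binP-computes _∸_ subP-computes L-computes (comp-computes S-computes ci)) R-computes)

-- Gödel numbers of programs with a hole

data Context : Set where
  hole                : Context
  Zᶜ Sᶜ Iᶜ Lᶜ Rᶜ      : Context
  compᶜ prᶜ recᶜ      : Context → Context → Context
  muᶜ                 : Context → Context

_⟦_⟧ : Context → Prog → Prog
hole        ⟦ r ⟧ = r
Zᶜ          ⟦ r ⟧ = Z
Sᶜ          ⟦ r ⟧ = S
Iᶜ          ⟦ r ⟧ = I
Lᶜ          ⟦ r ⟧ = L
Rᶜ          ⟦ r ⟧ = R
compᶜ C D   ⟦ r ⟧ = comp (C ⟦ r ⟧) (D ⟦ r ⟧)
prᶜ C D     ⟦ r ⟧ = pr (C ⟦ r ⟧) (D ⟦ r ⟧)
recᶜ C D    ⟦ r ⟧ = rec (C ⟦ r ⟧) (D ⟦ r ⟧)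
muᶜ C       ⟦ r ⟧ = mu (C ⟦ r ⟧)

⌜_⌝ : Prog → Context
⌜ Z ⌝        = Zᶜ
⌜ S ⌝        = Sᶜ
⌜ I ⌝        = Iᶜ
⌜ L ⌝        = Lᶜ
⌜ R ⌝        = Rᶜ
⌜ comp p q ⌝ = compᶜ ⌜ p ⌝ ⌜ q ⌝
⌜ pr p q ⌝   = prᶜ ⌜ p ⌝ ⌜ q ⌝
⌜ rec p q ⌝  = recᶜ ⌜ p ⌝ ⌜ q ⌝
⌜ mu p ⌝     = muᶜ ⌜ p ⌝

⌜⌝-⟦⟧ : ∀ p r → ⌜ p ⌝ ⟦ r ⟧ ≡ p
⌜⌝-⟦⟧ Z          r = refl
⌜⌝-⟦⟧ S          r = refl
⌜⌝-⟦⟧ I          r = refl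
⌜⌝-⟦⟧ L          r = refl
⌜⌝-⟦⟧ R          r = refl
⌜⌝-⟦⟧ (comp p q) r = cong₂ comp (⌜⌝-⟦⟧ p r) (⌜⌝-⟦⟧ q r)
⌜⌝-⟦⟧ (pr p q)   r = cong₂ pr (⌜⌝-⟦⟧ p r) (⌜⌝-⟦⟧ q r)
⌜⌝-⟦⟧ (rec p q)  r = cong₂ rec (⌜⌝-⟦⟧ p r) (⌜⌝-⟦⟧ q r)
⌜⌝-⟦⟧ (mu p)     r = cong mu (⌜⌝-⟦⟧ p r)

node : ℕ → ℕ → ℕ → ℕ
node t a b = 5 + pair t (pair a b)

code : Context → ℕ → ℕ
code hole        e = e
code Zᶜ          e = 0
code Sᶜ          e = 1
code Iᶜ          e = 2
code Lᶜ          e = 3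
code Rᶜ          e = 4
code (muᶜ C)     e = 5 + pair 0 (code C e)
code (compᶜ C D) e = node 1 (code C e) (code D e)
code (prᶜ C D)   e = node 2 (code C e) (code D e)
code (recᶜ C D)  e = node 3 (code C e) (code D e)

mutual
  decProg-stable : ∀ f f' k → k < f → k < f' → decProg f k ≡ decProg f' k
  decProg-stable (suc f) (suc f') 0 _ _ = refl
  decProg-stable (suc f) (suc f') 1 _ _ = refl
  decProg-stable (suc f) (suc f') 2 _ _ = refl
  decProg-stable (suc f) (suc f') 3 _ _ = refl
  decProg-stable (suc f) (suc f') 4 _ _ = refl
  decProg-stable (suc f) (suc f') (suc (suc (suc (suc (suc k))))) (s≤s k<f) (s≤s k<f')
    with unpair k | unpair₂≤ k
  ... | 0 , r | r≤k = cong mu (decProg-stable-below k<f k<f' r≤k)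
  ... | 1 , r | r≤k = cong₂ comp (decProg-stable-below k<f k<f' (≤-trans (unpair₁≤ r) r≤k))
                                 (decProg-stable-below k<f k<f' (≤-trans (unpair₂≤ r) r≤k))
  ... | 2 , r | r≤k = cong₂ pr (decProg-stable-below k<f k<f' (≤-trans (unpair₁≤ r) r≤k))
                               (decProg-stable-below k<f k<f' (≤-trans (unpair₂≤ r) r≤k))
  ... | suc (suc (suc _)) , r | r≤k = cong₂ rec (decProg-stable-below k<f k<f' (≤-trans (unpair₁≤ r) r≤k))
                                                (decProg-stable-below k<f k<f' (≤-trans (unpair₂≤ r) r≤k))

  decProg-stable-below : ∀ {f f' k j} → 5 + k ≤ f → 5 + k ≤ f' → j ≤ k → decProg f j ≡ decProg f' j
  decProg-stable-below {f} {f'} {k} {j} k<f k<f' j≤k = decProg-stable f f' j (below k<f) (below k<f')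
    where
    below : ∀ {g} → 5 + k ≤ g → j < g
    below = ≤-trans (s≤s (≤-trans j≤k (m≤n+m k 4)))

left<node : ∀ t a b → a < node t a b
left<node t a b = s≤s (≤-trans (≤-pairˡ a b) (≤-trans (≤-pairʳ t _) (m≤n+m _ 4)))

right<node : ∀ t a b → b < node t a b
right<node t a b = s≤s (≤-trans (≤-pairʳ a b) (≤-trans (≤-pairʳ t _) (m≤n+m _ 4)))

decProg-code : ∀ C e f → code C e < f → decProg f (code C e) ≡ C ⟦ prog e ⟧
decProg-code hole e f lt = decProg-stable f (suc e) e lt ≤-refl
decProg-code Zᶜ e (suc f) _ = refl
decProg-code Sᶜ e (suc f) _ = refl
decProg-code Iᶜ e (suc f) _ = refl
decProg-code Lᶜ e (suc f) _ = refl
decProg-code Rᶜ e (suc f) _ = refl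
decProg-code (muᶜ C) e (suc f) (s≤s lt) rewrite unpair-pair 0 (code C e) =
  cong mu (decProg-code C e f (<-≤-trans (s≤s (≤-trans (≤-pairʳ 0 (code C e)) (m≤n+m _ 4))) lt))
decProg-code (compᶜ C D) e (suc f) (s≤s lt)
  rewrite unpair-pair 1 (pair (code C e) (code D e)) | unpair-pair (code C e) (code D e) =
  cong₂ comp (decProg-code C e f (<-≤-trans (left<node 1 _ (code D e)) lt))
             (decProg-code D e f (<-≤-trans (right<node 1 (code C e) _) lt))
decProg-code (prᶜ C D) e (suc f) (s≤s lt)
  rewrite unpair-pair 2 (pair (code C e) (code D e)) | unpair-pair (code C e) (code D e) =
  cong₂ pr (decProg-code C e f (<-≤-trans (left<node 2 _ (code D e)) lt))
           (decProg-code D e f (<-≤-trans (right<node 2 (code C e) _) lt))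
decProg-code (recᶜ C D) e (suc f) (s≤s lt)
  rewrite unpair-pair 3 (pair (code C e) (code D e)) | unpair-pair (code C e) (code D e) =
  cong₂ rec (decProg-code C e f (<-≤-trans (left<node 3 _ (code D e)) lt))
            (decProg-code D e f (<-≤-trans (right<node 3 (code C e) _) lt))

prog-code : ∀ C e → prog (code C e) ≡ C ⟦ prog e ⟧
prog-code C e = decProg-code C e (suc (code C e)) ≤-refl

nodeP : ℕ → Prog → Prog → Prog
nodeP t p q = addConstP 5 (pr (constP t) (pr p q))

nodeP-computes : ∀ t → Computes p g → Computes q g′ → Computes (nodeP t p q) (λ x → node t (g x) (g′ x))
nodeP-computes t cp cq = addConstP-computes 5 (pr-computes (constP-computes t) (pr-computes cp cq))

codeP : Context → Prog
codeP hole        = I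
codeP Zᶜ          = constP 0
codeP Sᶜ          = constP 1
codeP Iᶜ          = constP 2
codeP Lᶜ          = constP 3
codeP Rᶜ          = constP 4
codeP (muᶜ C)     = addConstP 5 (pr (constP 0) (codeP C))
codeP (compᶜ C D) = nodeP 1 (codeP C) (codeP D)
codeP (prᶜ C D)   = nodeP 2 (codeP C) (codeP D)
codeP (recᶜ C D)  = nodeP 3 (codeP C) (codeP D)

codeP-computes : ∀ C → Computes (codeP C) (code C)
codeP-computes hole        = I-computes
codeP-computes Zᶜ          = constP-computes 0
codeP-computes Sᶜ          = constP-computes 1
codeP-computes Iᶜ          = constP-computes 2
codeP-computes Lᶜ          = constP-computes 3
codeP-computes Rᶜ          = constP-computes 4
codeP-computes (muᶜ C)     = addConstP-computes 5 (pr-computes (constP-computes 0) (codeP-computes C))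
codeP-computes (compᶜ C D) = nodeP-computes 1 (codeP-computes C) (codeP-computes D)
codeP-computes (prᶜ C D)   = nodeP-computes 2 (codeP-computes C) (codeP-computes D)
codeP-computes (recᶜ C D)  = nodeP-computes 3 (codeP-computes C) (codeP-computes D)

computes⇒computable : ∀ {p g} → Computes p g → Computable g
computes⇒computable {p} {g} cp =
  code ⌜ p ⌝ 0 , subst (λ r → Computes r g) (sym (trans (prog-code ⌜ p ⌝ 0) (⌜⌝-⟦⟧ p (prog 0)))) cp

code-computable : ∀ C → Computable (code C)
code-computable C = computes⇒computable (codeP-computes C)

module TermDecoding (m : ℕ) where

  mutual
    decTerm-mono : ∀ {s f f'} → f ≤ f' → ∀ k {t} →
      decTerm s m f k ≡ just t → decTerm s m f' k ≡ just t
    decTerm-mono {CS} {suc f} {suc f'} (s≤s le) k       eq = decNonUnit-mono le k eq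
    decTerm-mono {CM} {suc f} {suc f'} (s≤s le) zero    eq = eq
    decTerm-mono {CM} {suc f} {suc f'} (s≤s le) (suc k) eq = decNonUnit-mono le k eq

    decNonUnit-mono : ∀ {s f f'} → f ≤ f' → ∀ k {t} →
      decNonUnit s m f k ≡ just t → decNonUnit s m f' k ≡ just t
    decNonUnit-mono {s} {f} le k eq with k <? m
    ... | yes _ = eq
    ... | no _ with >>=-just-inv (decTerm s m f (unpair₁ (k ∸ m))) (decCont s m f (unpair₂ (k ∸ m))) eq
    ... | a , eq₁ , eq₂ rewrite decTerm-mono le (unpair₁ (k ∸ m)) eq₁ =
      decCont-mono le (unpair₂ (k ∸ m)) a eq₂

    decCont-mono : ∀ {s f f'} → f ≤ f' → ∀ b a {t} →
      decCont s m f b a ≡ just t → decCont s m f' b a ≡ just t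
    decCont-mono {s} {f} le b a eq with >>=-just-inv (decTerm s m f b) _ eq
    ... | u , eq₁ , eq₂ rewrite decTerm-mono le b eq₁ = eq₂

  decTerm-deterministic : ∀ {s f f'} k {t t'} →
    decTerm s m f k ≡ just t → decTerm s m f' k ≡ just t' → t ≡ t'
  decTerm-deterministic {s} {f} {f'} k eq eq' =
    just-injective (trans (sym (decTerm-mono (m≤m⊔n f f') k eq)) (decTerm-mono (m≤n⊔m f f') k eq'))

  decNonUnit-var : ∀ s f k (k<m : k < m) → decNonUnit s m f k ≡ just (var (fromℕ< k<m))
  decNonUnit-var s f k k<m with k <? m
  ... | yes _   = refl
  ... | no  k≮m = ⊥-elim (k≮m k<m)

  decNonUnit-node : ∀ s f k → m ≤ k →
    decNonUnit s m f k ≡ (decTerm s m f (unpair₁ (k ∸ m)) >>= decCont s m f (unpair₂ (k ∸ m)))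
  decNonUnit-node s f k m≤k with k <? m
  ... | yes k<m = ⊥-elim (<⇒≱ k<m m≤k)
  ... | no _    = refl

  decNonUnit-∙ : ∀ s f k {a b ta tb} → m ≤ k → k ∸ m ≡ pair a b →
    decTerm s m f a ≡ just ta → decTerm s m f b ≡ just tb → decNonUnit s m f k ≡ just (ta ∙ tb)
  decNonUnit-∙ s f k {a} {b} m≤k eq eqa eqb
    rewrite decNonUnit-node s f k m≤k | eq | unpair₁-pair a b | unpair₂-pair a b | eqa | eqb = refl

  mutual
    decTerm-total : 1 ≤ m → ∀ s f k → k < f → Σ[ t ∈ Term s m ] decTerm s m f k ≡ just t
    decTerm-total 1≤m CS (suc f) k       (s≤s k≤f) = decNonUnit-total 1≤m CS f k k≤f
    decTerm-total 1≤m CM (suc f) zero    _         = ε , refl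
    decTerm-total 1≤m CM (suc f) (suc k) (s≤s k<f) = decNonUnit-total 1≤m CM f k (<⇒≤ k<f)

    decNonUnit-total : 1 ≤ m → ∀ s f k → k ≤ f → Σ[ t ∈ Term s m ] decNonUnit s m f k ≡ just t
    decNonUnit-total 1≤m s f k k≤f with k <? m
    ... | yes k<m = var (fromℕ< k<m) , refl
    ... | no k≮m
      with decTerm-total 1≤m s f (unpair₁ (k ∸ m)) (<-≤-trans (unpair₁-∸< 1≤m (≮⇒≥ k≮m)) k≤f)
         | decTerm-total 1≤m s f (unpair₂ (k ∸ m)) (<-≤-trans (unpair₂-∸< 1≤m (≮⇒≥ k≮m)) k≤f)
    ... | ta , eqa | tb , eqb rewrite eqa | eqb = ta ∙ tb , refl

≈-setoid : ℕ → ℕ → Sig → Setoid 0ℓ 0ℓ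
≈-setoid n e s = record
  { Carrier       = Term s n
  ; _≈_           = Cong n e s
  ; isEquivalence = record { refl = ≈-refl ; sym = ≈-sym ; trans = ≈-trans }
  }

≡⇒≈ : ∀ {n e s} {t u : Term s n} → t ≡ u → Cong n e s t u
≡⇒≈ refl = ≈-refl

from-hom : ∀ {s m e i} (J : Iso s m e i) (t u : Term s m) →
  Cong m e s (Iso.from J (t ∙ u)) (Iso.from J t ∙ Iso.from J u)
from-hom J t u = ≈-trans (from-cong (∙-cong (≈-sym (to-from t)) (≈-sym (to-from u))))
                         (≈-trans (from-cong (≈-sym (to-hom (from t) (from u)))) (from-to (from t ∙ from u)))
  where open Iso J

from-unit : ∀ {m e i} (J : Iso CM m e i) → Cong m e CM (Iso.from J ε) ε
from-unit J = ≈-trans (from-cong (≈-sym to-unit)) (from-to ε)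
  where open Iso J

-- CS_n ≤c CM_n

module SemigroupsToMonoids (n : ℕ) (1≤n : 1 ≤ n) where

  open TermDecoding n

  ι : Term CS n → Term CM n
  ι (var i) = var i
  ι (a ∙ b) = ι a ∙ ι b

  -- The CM-coding is the CS-coding shifted up by one (0 codes ε), applied recursively.
  translateStep : ℕ → ℕ → ℕ
  translateStep c hist =
    ifz (n ∸ c) (suc (n + pair (lookupHistory (unpair₁ (c ∸ n)) c hist) (lookupHistory (unpair₂ (c ∸ n)) c hist)))
                (suc c)

  translateStepP : Prog
  translateStepP =
    ifzP (binP subP (constP n) L) (addConstP (suc n) (pr (lookupP (comp L offsetP)) (lookupP (comp R offsetP))))
         (comp S L)
    where offsetP = binP subP L (constP n)

  translateStepP-computes : Computes translateStepP (λ w → translateStep (unpair₁ w) (unpair₂ w))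
  translateStepP-computes =
    ifzP-computes (binP-computes _∸_ subP-computes (constP-computes n) L-computes)
      (addConstP-computes (suc n) (pr-computes (lookupP-computes (comp-computes L-computes offset-computes))
                                               (lookupP-computes (comp-computes R-computes offset-computes))))
      (comp-computes S-computes L-computes)
    where offset-computes = binP-computes _∸_ subP-computes L-computes (constP-computes n)

  translateP : Prog
  translateP = courseOfValuesP translateStepP

  abstract
    translate : ℕ → ℕ
    translate c = translateStep c (history translateStep c)

    translateP-computes : Computes translateP translate
    translateP-computes = courseOfValuesP-computes {step = translateStep} translateStepP-computes

    translate-var : ∀ {c} → c < n → translate c ≡ suc c
    translate-var {c} c<n with n ∸ c | m>n⇒m∸n≢0 c<n
    ... | zero  | n∸c≢0 = ⊥-elim (n∸c≢0 refl)
    ... | suc _ | _     = refl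

    translate-∙ : ∀ {c} → n ≤ c →
      translate c ≡ suc (n + pair (translate (unpair₁ (c ∸ n))) (translate (unpair₂ (c ∸ n))))
    translate-∙ {c} n≤c rewrite m≤n⇒m∸n≡0 n≤c =
      cong (λ k → suc (n + k)) (cong₂ pair (lookupHistory-history translateStep (unpair₁-∸< 1≤n n≤c))
                                           (lookupHistory-history translateStep (unpair₂-∸< 1≤n n≤c)))

  Decodes : (s : Sig) → ℕ → Term s n → Set
  Decodes s k t = Σ[ f ∈ ℕ ] decTerm s n f k ≡ just t

  decodes⇒decodeTerm : ∀ {s k t} → Decodes s k t → decodeTerm s n k ≡ just t
  decodes⇒decodeTerm {s} {k} (f , eq) with decTerm-total 1≤n s (suc k) k ≤-refl
  ... | t' , eq' = trans eq' (cong just (decTerm-deterministic {s} {suc k} {f} k eq' eq))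

  decodes-translate : ∀ f c → c < f →
    Σ[ t ∈ Term CS n ] decTerm CS n f c ≡ just t × Decodes CM (translate c) (ι t)
  decodes-translate (suc f) c (s≤s c≤f) with n ≤? c
  ... | no n≰c = var (fromℕ< c<n) , decNonUnit-var CS f c c<n , 2 , decodes-var
    where
    c<n = ≰⇒> n≰c
    decodes-var : decTerm CM n 2 (translate c) ≡ just (var (fromℕ< c<n))
    decodes-var rewrite translate-var c<n = decNonUnit-var CM 1 c c<n
  ... | yes n≤c
    with decodes-translate f (unpair₁ (c ∸ n)) (<-≤-trans (unpair₁-∸< 1≤n n≤c) c≤f)
       | decodes-translate f (unpair₂ (c ∸ n)) (<-≤-trans (unpair₂-∸< 1≤n n≤c) c≤f)
  ... | ta , eqa , fa , eca | tb , eqb , fb , ecb =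
    ta ∙ tb , decNonUnit-∙ CS f c n≤c (sym (pair-unpair (c ∸ n))) eqa eqb , suc (suc (fa ⊔ fb)) , decodes-∙
    where
    decodes-∙ : decTerm CM n (suc (suc (fa ⊔ fb))) (translate c) ≡ just (ι ta ∙ ι tb)
    decodes-∙ rewrite translate-∙ n≤c =
      decNonUnit-∙ CM (suc (fa ⊔ fb)) (n + pair a′ b′) {a′} {b′} (m≤m+n n _) (m+n∸m≡n n (pair a′ b′))
        (decTerm-mono (m≤n⇒m≤1+n (m≤m⊔n fa fb)) a′ eca) (decTerm-mono (m≤n⇒m≤1+n (m≤n⊔m fa fb)) b′ ecb)
      where
      a′ = translate (unpair₁ (c ∸ n))
      b′ = translate (unpair₂ (c ∸ n))

  decodeTerm-translate : ∀ c →
    Σ[ t ∈ Term CS n ] decodeTerm CS n c ≡ just t × decodeTerm CM n (translate c) ≡ just (ι t)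
  decodeTerm-translate c with decodes-translate (suc c) c ≤-refl
  ... | t , eq , decodes = t , eq , decodes⇒decodeTerm decodes

  translate-var≢∙ : ∀ {c c'} → c < n → n ≤ c' → translate c ≢ translate c'
  translate-var≢∙ {c} {c'} c<n n≤c' eq = <⇒≱ c<n (≤-trans (m≤m+n n _) (≤-reflexive (suc-injective
    (trans (sym (translate-∙ n≤c')) (trans (sym eq) (translate-var c<n))))))

  translate-injective : ∀ f {c c'} → c < f → c' < f → translate c ≡ translate c' → c ≡ c'
  translate-injective (suc f) {c} {c'} (s≤s c≤f) (s≤s c'≤f) eq with n ≤? c | n ≤? c'
  ... | no n≰c  | no n≰c'  = suc-injective (trans (sym (translate-var (≰⇒> n≰c))) (trans eq (translate-var (≰⇒> n≰c'))))
  ... | no n≰c  | yes n≤c' = ⊥-elim (translate-var≢∙ (≰⇒> n≰c) n≤c' eq)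
  ... | yes n≤c | no n≰c'  = ⊥-elim (translate-var≢∙ (≰⇒> n≰c') n≤c (sym eq))
  ... | yes n≤c | yes n≤c'
    with pair-injective (+-cancelˡ-≡ n _ _ (suc-injective (trans (sym (translate-∙ n≤c)) (trans eq (translate-∙ n≤c')))))
  ... | eq₁ , eq₂ = begin
    c           ≡⟨ sym (m∸n+n≡m n≤c) ⟩
    c ∸ n + n   ≡⟨ cong (_+ n) (unpair-injective left right) ⟩
    c' ∸ n + n  ≡⟨ m∸n+n≡m n≤c' ⟩
    c'          ∎
    where
    open ≡-Reasoning
    left  = translate-injective f (<-≤-trans (unpair₁-∸< 1≤n n≤c) c≤f) (<-≤-trans (unpair₁-∸< 1≤n n≤c') c'≤f) eq₁
    right = translate-injective f (<-≤-trans (unpair₂-∸< 1≤n n≤c) c≤f) (<-≤-trans (unpair₂-∸< 1≤n n≤c') c'≤f) eq₂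

  translatePair : ℕ → ℕ
  translatePair j = pair (translate (unpair₁ j)) (translate (unpair₂ j))

  translatePairP : Prog
  translatePairP = pr (comp translateP L) (comp translateP R)

  translatePairP-computes : Computes translatePairP translatePair
  translatePairP-computes =
    pr-computes (comp-computes translateP-computes L-computes) (comp-computes translateP-computes R-computes)

  translatePair-injective : ∀ {j j'} → translatePair j ≡ translatePair j' → j ≡ j'
  translatePair-injective {j} {j'} eq with pair-injective eq
  ... | eq₁ , eq₂ = unpair-injective left right
    where
    left  = translate-injective (suc (unpair₁ j ⊔ unpair₁ j')) (s≤s (m≤m⊔n _ _)) (s≤s (m≤n⊔m _ _)) eq₁
    right = translate-injective (suc (unpair₂ j ⊔ unpair₂ j')) (s≤s (m≤m⊔n _ _)) (s≤s (m≤n⊔m _ _)) eq₂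

  decodePair-translatePair : ∀ j → Σ[ t ∈ Term CS n ] Σ[ u ∈ Term CS n ]
    decodePair CS n j ≡ just (t , u) × decodePair CM n (translatePair j) ≡ just (ι t , ι u)
  decodePair-translatePair j with decodeTerm-translate (unpair₁ j) | decodeTerm-translate (unpair₂ j)
  ... | t , eqt , eqt′ | u , equ , equ′ = t , u , decodeCS , decodeCM
    where
    decodeCS : decodePair CS n j ≡ just (t , u)
    decodeCS rewrite eqt | equ = refl
    decodeCM : decodePair CM n (translatePair j) ≡ just (ι t , ι u)
    decodeCM rewrite unpair₁-pair (translate (unpair₁ j)) (translate (unpair₂ j))
                   | unpair₂-pair (translate (unpair₁ j)) (translate (unpair₂ j)) | eqt′ | equ′ = refl

  mismatch : ℕ → ℕ
  mismatch w = ∣ translatePair (unpair₁ w) - unpair₂ w ∣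

  mismatchP : Prog
  mismatchP = binP distP (comp translatePairP L) R

  mismatchP-computes : Computes mismatchP mismatch
  mismatchP-computes = binP-computes ∣_-_∣ distP-computes (comp-computes translatePairP-computes L-computes) R-computes

  searchP : Prog
  searchP = mu mismatchP

  mismatch-pair : ∀ j k → mismatch (pair j k) ≡ ∣ translatePair j - k ∣
  mismatch-pair j k = cong₂ (λ a b → ∣ translatePair a - b ∣) (unpair₁-pair j k) (unpair₂-pair j k)

  searchP-sound : ∀ f k {j} → eval f searchP k ≡ just j → translatePair j ≡ k
  searchP-sound f k {j} eq = ∣m-n∣≡0⇒m≡n (trans (sym (mismatch-pair j k)) (mu-sound mismatchP-computes f k eq))

  searchP-translatePair : ∀ j → Σ[ f ∈ ℕ ] eval f searchP (translatePair j) ≡ just j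
  searchP-translatePair j = mu-complete mismatchP-computes (translatePair j) j
    (trans (mismatch-pair j (translatePair j)) (∣n-n∣≡0 (translatePair j)))
    λ u u<j eq → <-irrefl (translatePair-injective (∣m-n∣≡0⇒m≡n (trans (sym (mismatch-pair u (translatePair j))) eq)))
                          u<j

  reductionContext : Context
  reductionContext = compᶜ hole ⌜ searchP ⌝

  abstract
    h : ℕ → ℕ
    h = code reductionContext

    h-computable : Computable h
    h-computable = code-computable reductionContext

    prog-h : ∀ e → prog (h e) ≡ comp (prog e) searchP
    prog-h e = trans (prog-code reductionContext e) (cong (comp (prog e)) (⌜⌝-⟦⟧ searchP (prog e)))

  ∈W-h⁻ : ∀ e k → k ∈W h e → Σ[ j ∈ ℕ ] translatePair j ≡ k × j ∈W e
  ∈W-h⁻ e k k∈ with comp-halts⁻ k (subst (λ p → Halts p k) (prog-h e) k∈)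
  ... | f , j , eq , j∈ = j , searchP-sound f k eq , j∈

  ∈W-h⁺ : ∀ e j → j ∈W e → translatePair j ∈W h e
  ∈W-h⁺ e j j∈ = subst (λ p → Halts p (translatePair j)) (sym (prog-h e))
    (comp-halts⁺ {f = proj₁ (searchP-translatePair j)} (proj₂ (searchP-translatePair j)) j∈)

  ι-cong : ∀ {e t u} → Cong n e CS t u → Cong n (h e) CM (ι t) (ι u)
  ι-cong {e} (base j j∈ eq) with decodePair-translatePair j
  ... | t , u , eqCS , eqCM with ,-injective (just-injective (trans (sym eq) eqCS))
  ...   | refl , refl = base (translatePair j) (∈W-h⁺ e j j∈) eqCM
  ι-cong ≈-refl        = ≈-refl
  ι-cong (≈-sym c)     = ≈-sym (ι-cong c)
  ι-cong (≈-trans c d) = ≈-trans (ι-cong c) (ι-cong d)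
  ι-cong (∙-cong c d)  = ∙-cong (ι-cong c) (ι-cong d)
  ι-cong (assoc t u v) = assoc (ι t) (ι u) (ι v)
  ι-cong (comm t u)    = comm (ι t) (ι u)

  ∈W-h-relation : ∀ {e k t u} → k ∈W h e → decodePair CM n k ≡ just (t , u) →
    Σ[ t₀ ∈ Term CS n ] Σ[ u₀ ∈ Term CS n ] t ≡ ι t₀ × u ≡ ι u₀ × Cong n e CS t₀ u₀
  ∈W-h-relation {e} {k} k∈ eq =
    let j , jk , j∈ = ∈W-h⁻ e k k∈
        t₀ , u₀ , eqCS , eqCM = decodePair-translatePair j
        t≡ , u≡ = ,-injective (just-injective
                    (trans (sym eq) (subst (λ k → decodePair CM n k ≡ just (ι t₀ , ι u₀)) jk eqCM)))
    in t₀ , u₀ , t≡ , u≡ , base j j∈ eqCS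

  -- Maybe (Term CS n) is the term semigroup with an identity, nothing, adjoined.
  _∙?_ : Maybe (Term CS n) → Maybe (Term CS n) → Maybe (Term CS n)
  nothing ∙? b       = b
  just a  ∙? nothing = just a
  just a  ∙? just b  = just (a ∙ b)

  strip : Term CM n → Maybe (Term CS n)
  strip ε       = nothing
  strip (var i) = just (var i)
  strip (t ∙ u) = strip t ∙? strip u

  strip-ι : ∀ a → strip (ι a) ≡ just a
  strip-ι (var i) = refl
  strip-ι (a ∙ b) rewrite strip-ι a | strip-ι b = refl

  module _ {e : ℕ} where

    infix 4 _≈?_
    _≈?_ : Maybe (Term CS n) → Maybe (Term CS n) → Set
    _≈?_ = Pointwise (Cong n e CS)

    ∙?-cong : ∀ {a a' b b'} → a ≈? a' → b ≈? b' → a ∙? b ≈? a' ∙? b'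
    ∙?-cong nothing  b≈b'     = b≈b'
    ∙?-cong (just r) nothing  = just r
    ∙?-cong (just r) (just s) = just (∙-cong r s)

    ∙?-assoc : ∀ a b c → (a ∙? b) ∙? c ≈? a ∙? (b ∙? c)
    ∙?-assoc nothing  b        c        = Pointwise.refl ≈-refl
    ∙?-assoc (just a) nothing  c        = Pointwise.refl ≈-refl
    ∙?-assoc (just a) (just b) nothing  = just ≈-refl
    ∙?-assoc (just a) (just b) (just c) = just (assoc a b c)

    ∙?-comm : ∀ a b → a ∙? b ≈? b ∙? a
    ∙?-comm nothing  nothing  = nothing
    ∙?-comm nothing  (just b) = just ≈-refl
    ∙?-comm (just a) nothing  = just ≈-refl
    ∙?-comm (just a) (just b) = just (comm a b)

    ∙?-identityʳ : ∀ a → a ∙? nothing ≈? a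
    ∙?-identityʳ nothing  = nothing
    ∙?-identityʳ (just a) = just ≈-refl

    strip-cong : ∀ {t u} → Cong n (h e) CM t u → strip t ≈? strip u
    strip-cong (base k k∈ eq) =
      let t₀ , u₀ , t≡ι , u≡ι , c = ∈W-h-relation k∈ eq
      in subst₂ _≈?_ (sym (trans (cong strip t≡ι) (strip-ι t₀)))
                     (sym (trans (cong strip u≡ι) (strip-ι u₀))) (just c)
    strip-cong ≈-refl                         = Pointwise.refl ≈-refl
    strip-cong (≈-sym c)                      = Pointwise.sym ≈-sym (strip-cong c)
    strip-cong (≈-trans c d)                  = Pointwise.trans ≈-trans (strip-cong c) (strip-cong d)
    strip-cong (∙-cong c d)                   = ∙?-cong (strip-cong c) (strip-cong d)
    strip-cong (assoc t u v)                  = ∙?-assoc (strip t) (strip u) (strip v)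
    strip-cong (comm t u)                     = ∙?-comm (strip t) (strip u)
    strip-cong (identʳ t)                     = ∙?-identityʳ (strip t)

    strip-cong′ : ∀ {t u a b} → Cong n (h e) CM t u → strip t ≡ just a → strip u ≡ just b → Cong n e CS a b
    strip-cong′ c eqt equ = drop-just (subst₂ _≈?_ eqt equ (strip-cong c))

    ι≉ε : ∀ a → ¬ Cong n (h e) CM (ι a) ε
    ι≉ε a c with subst (_≈? nothing) (strip-ι a) (strip-cong c)
    ... | ()

  strip≡nothing : ∀ {e} t → strip t ≡ nothing → Cong n e CM t ε
  strip≡nothing ε       _ = ≈-refl
  strip≡nothing (t ∙ u) eq with strip t in eqt | strip u in equ
  strip≡nothing (t ∙ u) _  | nothing | nothing =
    ≈-trans (∙-cong (strip≡nothing t eqt) (strip≡nothing u equ)) (identʳ ε)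
  strip≡nothing (t ∙ u) () | just _  | nothing
  strip≡nothing (t ∙ u) () | just _  | just _

  strip≡just : ∀ {e} t {a} → strip t ≡ just a → Cong n e CM t (ι a)
  strip≡just (var i) refl = ≈-refl
  strip≡just (t ∙ u) eq with strip t in eqt | strip u in equ | eq
  ... | nothing | just b  | refl =
    ≈-trans (∙-cong (strip≡nothing t eqt) (strip≡just u equ)) (≈-trans (comm ε (ι b)) (identʳ (ι b)))
  ... | just a  | nothing | refl =
    ≈-trans (∙-cong (strip≡just t eqt) (strip≡nothing u equ)) (identʳ (ι a))
  ... | just a  | just b  | refl = ∙-cong (strip≡just t eqt) (strip≡just u equ)

  strip-nonempty : ∀ {e} t → ¬ Cong n e CM t ε → Σ[ a ∈ Term CS n ] strip t ≡ just a
  strip-nonempty t t≉ε with strip t in eq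
  ... | just a  = a , refl
  ... | nothing = ⊥-elim (t≉ε (strip≡nothing t eq))

  ext : (Term CS n → Term CS n) → Term CM n → Term CM n
  ext f ε       = ε
  ext f (var v) = ι (f (var v))
  ext f (t ∙ u) = ext f t ∙ ext f u

  module _ {j} (f : Term CS n → Term CS n) (f-hom : ∀ a b → Cong n j CS (f (a ∙ b)) (f a ∙ f b)) where

    ext-ι : ∀ a → Cong n (h j) CM (ext f (ι a)) (ι (f a))
    ext-ι (var v) = ≈-refl
    ext-ι (a ∙ b) = ≈-trans (∙-cong (ext-ι a) (ext-ι b)) (ι-cong (≈-sym (f-hom a b)))

    ext-cong : ∀ {e} → (∀ {a b} → Cong n e CS a b → Cong n j CS (f a) (f b)) →
      ∀ {t u} → Cong n (h e) CM t u → Cong n (h j) CM (ext f t) (ext f u)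
    ext-cong f-cong (base k k∈ eq) =
      let t₀ , u₀ , t≡ι , u≡ι , c = ∈W-h-relation k∈ eq
      in subst₂ (λ t u → Cong n (h j) CM (ext f t) (ext f u)) (sym t≡ι) (sym u≡ι)
                (≈-trans (ext-ι t₀) (≈-trans (ι-cong (f-cong c)) (≈-sym (ext-ι u₀))))
    ext-cong f-cong ≈-refl        = ≈-refl
    ext-cong f-cong (≈-sym c)     = ≈-sym (ext-cong f-cong c)
    ext-cong f-cong (≈-trans c d) = ≈-trans (ext-cong f-cong c) (ext-cong f-cong d)
    ext-cong f-cong (∙-cong c d)  = ∙-cong (ext-cong f-cong c) (ext-cong f-cong d)
    ext-cong f-cong (assoc t u v) = assoc (ext f t) (ext f u) (ext f v)
    ext-cong f-cong (comm t u)    = comm (ext f t) (ext f u)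
    ext-cong f-cong (identʳ t)    = identʳ (ext f t)

    ext-ext : ∀ g → (∀ v → Cong n j CS (f (g (var v))) (var v)) →
      ∀ t → Cong n (h j) CM (ext f (ext g t)) t
    ext-ext g inverse ε       = ≈-refl
    ext-ext g inverse (var v) = ≈-trans (ext-ι (g (var v))) (ι-cong (inverse v))
    ext-ext g inverse (t ∙ u) = ∙-cong (ext-ext g inverse t) (ext-ext g inverse u)

  iso⁺ : ∀ {e i} → Iso CS n e i → Iso CM n (h e) (h i)
  iso⁺ J = record
    { to        = ext to
    ; from      = ext from
    ; to-cong   = ext-cong to to-hom to-cong
    ; from-cong = ext-cong from (from-hom J) from-cong
    ; to-hom    = λ t u → ≈-refl
    ; to-unit   = ≈-refl
    ; from-to   = ext-ext from (from-hom J) to (from-to ∘ var)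
    ; to-from   = ext-ext to to-hom from (to-from ∘ var)
    }
    where open Iso J

  module Restrict {e i} (J : Iso CM n (h e) (h i)) where
    open Iso J

    to-ι≉ε : ∀ a → ¬ Cong n (h i) CM (to (ι a)) ε
    to-ι≉ε a c = ι≉ε a (≈-trans (≈-sym (from-to (ι a))) (≈-trans (from-cong c) (from-unit J)))

    from-ι≉ε : ∀ a → ¬ Cong n (h e) CM (from (ι a)) ε
    from-ι≉ε a c = ι≉ε a (≈-trans (≈-sym (to-from (ι a))) (≈-trans (to-cong c) to-unit))

    to′ from′ : Term CS n → Term CS n
    to′   a = proj₁ (strip-nonempty (to (ι a)) (to-ι≉ε a))
    from′ a = proj₁ (strip-nonempty (from (ι a)) (from-ι≉ε a))

    strip-to : ∀ a → strip (to (ι a)) ≡ just (to′ a)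
    strip-to a = proj₂ (strip-nonempty (to (ι a)) (to-ι≉ε a))

    strip-from : ∀ a → strip (from (ι a)) ≡ just (from′ a)
    strip-from a = proj₂ (strip-nonempty (from (ι a)) (from-ι≉ε a))

    iso⁻ : Iso CS n e i
    iso⁻ = record
      { to        = to′
      ; from      = from′
      ; to-cong   = λ {a} {b} c → strip-cong′ (to-cong (ι-cong c)) (strip-to a) (strip-to b)
      ; from-cong = λ {a} {b} c → strip-cong′ (from-cong (ι-cong c)) (strip-from a) (strip-from b)
      ; to-hom    = λ a b → strip-cong′ (to-hom (ι a) (ι b)) (strip-to (a ∙ b)) (cong₂ _∙?_ (strip-to a) (strip-to b))
      ; to-unit   = tt
      ; from-to   = λ a → strip-cong′ (≈-trans (from-cong (≈-sym (strip≡just _ (strip-to a)))) (from-to (ι a)))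
                                       (strip-from (to′ a)) (strip-ι a)
      ; to-from   = λ a → strip-cong′ (≈-trans (to-cong (≈-sym (strip≡just _ (strip-from a)))) (to-from (ι a)))
                                       (strip-to (from′ a)) (strip-ι a)
      }

  reduction : ≅[ CS , n ] ≤c ≅[ CM , n ]
  reduction = h , h-computable , λ e i → mk⇔ iso⁺ Restrict.iso⁻

-- CM_n ≤c CS_{n+1}

module MonoidsToSemigroups (n : ℕ) where

  σ : Term CM n → Term CS (suc n)
  σ ε       = var Fin.zero
  σ (var i) = var (Fin.suc i)
  σ (t ∙ u) = σ t ∙ σ u

  ρ : Term CS (suc n) → Term CM n
  ρ (var Fin.zero)    = ε
  ρ (var (Fin.suc i)) = var i
  ρ (a ∙ b)           = ρ a ∙ ρ b

  ρ-σ : ∀ t → ρ (σ t) ≡ t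
  ρ-σ ε       = refl
  ρ-σ (var i) = refl
  ρ-σ (t ∙ u) = cong₂ _∙_ (ρ-σ t) (ρ-σ u)

  σ-ρ : ∀ a → σ (ρ a) ≡ a
  σ-ρ (var Fin.zero)    = refl
  σ-ρ (var (Fin.suc i)) = refl
  σ-ρ (a ∙ b)           = cong₂ _∙_ (σ-ρ a) (σ-ρ b)

  σ×σ : Term CM n × Term CM n → Term CS (suc n) × Term CS (suc n)
  σ×σ = Product.map σ σ

  ρ×ρ : Term CS (suc n) × Term CS (suc n) → Term CM n × Term CM n
  ρ×ρ = Product.map ρ ρ

  open TermDecoding n using () renaming (decNonUnit-var to decNonUnitₙ-var; decNonUnit-node to decNonUnitₙ-node)
  open TermDecoding (suc n) using (decNonUnit-var; decNonUnit-node; decNonUnit-∙)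

  -- The CM-coding in n variables is the CS-coding in n + 1 variables with ε in place of x₀.
  mutual
    decTerm-σ : ∀ f k → decTerm CS (suc n) f k ≡ map σ (decTerm CM n f k)
    decTerm-σ zero    k       = refl
    decTerm-σ (suc f) zero    = decNonUnit-var CS f 0 (s≤s z≤n)
    decTerm-σ (suc f) (suc k) = decNonUnit-σ f k

    decNonUnit-σ : ∀ f k → decNonUnit CS (suc n) f (suc k) ≡ map σ (decNonUnit CM n f k)
    decNonUnit-σ f k with n ≤? k
    ... | no n≰k rewrite decNonUnit-var CS f (suc k) (s≤s (≰⇒> n≰k)) | decNonUnitₙ-var CM f k (≰⇒> n≰k) = refl
    ... | yes n≤k rewrite decNonUnit-node CS f (suc k) (s≤s n≤k) | decNonUnitₙ-node CM f k n≤k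
                        | decTerm-σ f (unpair₁ (k ∸ n)) with decTerm CM n f (unpair₁ (k ∸ n))
    ... | nothing = refl
    ... | just t rewrite decTerm-σ f (unpair₂ (k ∸ n)) with decTerm CM n f (unpair₂ (k ∸ n))
    ... | nothing = refl
    ... | just u  = refl

  decodePair-σ : ∀ k → decodePair CS (suc n) k ≡ map σ×σ (decodePair CM n k)
  decodePair-σ k rewrite decTerm-σ (suc (unpair₁ k)) (unpair₁ k) with decodeTerm CM n (unpair₁ k)
  ... | nothing = refl
  ... | just t rewrite decTerm-σ (suc (unpair₂ k)) (unpair₂ k) with decodeTerm CM n (unpair₂ k)
  ... | nothing = refl
  ... | just u  = refl

  decodePair-ρ : ∀ k {a b} → decodePair CS (suc n) k ≡ just (a , b) → decodePair CM n k ≡ just (ρ a , ρ b)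
  decodePair-ρ k {a} {b} eq = begin
    d                        ≡⟨ sym (trans (map-cong ρ×ρ∘σ×σ≗id d) (map-id d)) ⟩
    map (ρ×ρ ∘ σ×σ) d        ≡⟨ map-∘ d ⟩
    map ρ×ρ (map σ×σ d)      ≡⟨ cong (map ρ×ρ) (trans (sym (decodePair-σ k)) eq) ⟩
    just (ρ a , ρ b)         ∎
    where
    open ≡-Reasoning
    d = decodePair CM n k
    ρ×ρ∘σ×σ≗id : ∀ tu → ρ×ρ (σ×σ tu) ≡ tu
    ρ×ρ∘σ×σ≗id (t , u) = cong₂ _,_ (ρ-σ t) (ρ-σ u)

  x₀ : Term CS (suc n)
  x₀ = var Fin.zero

  unitLawCode : ℕ → ℕ
  unitLawCode i = pair (suc n + pair i 0) i

  decodePair-unitLawCode : ∀ i (i<1+n : i < suc n) →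
    decodePair CS (suc n) (unitLawCode i) ≡ just (var (fromℕ< i<1+n) ∙ x₀ , var (fromℕ< i<1+n))
  decodePair-unitLawCode i i<1+n
    rewrite unpair₁-pair (suc n + pair i 0) i | unpair₂-pair (suc n + pair i 0) i
          | decNonUnit-∙ CS (suc n + pair i 0) (suc n + pair i 0) {i} {0} (m≤m+n (suc n) _) (m+n∸m≡n (suc n) _)
              (decNonUnit-var CS (n + pair i 0) i i<1+n) (decNonUnit-var CS (n + pair i 0) 0 (s≤s z≤n))
          | decNonUnit-var CS i i i<1+n = refl

  unitLawTest : ℕ → ℕ
  unitLawTest k = (unpair₂ k ∸ n) + ∣ unpair₁ k - (suc n + pair (unpair₂ k) 0) ∣

  unitLawTestP : Prog
  unitLawTestP = binP addP (binP subP R (constP n)) (binP distP L (addConstP (suc n) (pr R Z)))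

  unitLawTestP-computes : Computes unitLawTestP unitLawTest
  unitLawTestP-computes =
    binP-computes _+_ addP-computes (binP-computes _∸_ subP-computes R-computes (constP-computes n))
      (binP-computes ∣_-_∣ distP-computes L-computes (addConstP-computes (suc n) (pr-computes R-computes Z-computes)))

  unitLawTest≡0⇒ : ∀ k → unitLawTest k ≡ 0 → Σ[ i ∈ ℕ ] i < suc n × k ≡ unitLawCode i
  unitLawTest≡0⇒ k eq =
    unpair₂ k , s≤s (m∸n≡0⇒m≤n (m+n≡0⇒m≡0 (unpair₂ k ∸ n) eq)) ,
    trans (sym (pair-unpair k)) (cong (λ a → pair a (unpair₂ k)) unpair₁-k)
    where
    unpair₁-k : unpair₁ k ≡ suc n + pair (unpair₂ k) 0
    unpair₁-k = ∣m-n∣≡0⇒m≡n (m+n≡0⇒n≡0 (unpair₂ k ∸ n) eq)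

  unitLawTest-unitLawCode : ∀ i → i < suc n → unitLawTest (unitLawCode i) ≡ 0
  unitLawTest-unitLawCode i (s≤s i≤n)
    rewrite unpair₁-pair (suc n + pair i 0) i | unpair₂-pair (suc n + pair i 0) i | m≤n⇒m∸n≡0 i≤n =
    ∣n-n∣≡0 (suc n + pair i 0)

  reductionContext : Context
  reductionContext = compᶜ (recᶜ Zᶜ (compᶜ hole ⌜ comp R R ⌝)) ⌜ pr (comp signP unitLawTestP) I ⌝

  abstract
    h : ℕ → ℕ
    h = code reductionContext

    h-computable : Computable h
    h-computable = code-computable reductionContext

    prog-h : ∀ e → prog (h e) ≡ ifzP unitLawTestP Z (prog e)
    prog-h e = trans (prog-code reductionContext e) (cong (comp _) (⌜⌝-⟦⟧ _ (prog e)))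

  ∈W-h⁻ : ∀ e k → k ∈W h e → (Σ[ i ∈ ℕ ] i < suc n × k ≡ unitLawCode i) ⊎ k ∈W e
  ∈W-h⁻ e k k∈ with unitLawTest k ≟ 0
  ... | yes eq = inj₁ (unitLawTest≡0⇒ k eq)
  ... | no  ne = inj₂ (Equivalence.to (ifzP-halts-suc unitLawTestP-computes Z-computes ne)
                                      (subst (λ p → Halts p k) (prog-h e) k∈))

  unitLawCode-∈W-h : ∀ e i → i < suc n → unitLawCode i ∈W h e
  unitLawCode-∈W-h e i i<1+n = subst (λ p → Halts p (unitLawCode i)) (sym (prog-h e))
    (ifzP-halts-zero unitLawTestP-computes Z-computes (unitLawTest-unitLawCode i i<1+n))

  ∈W-h⁺ : ∀ e k → k ∈W e → k ∈W h e
  ∈W-h⁺ e k k∈ with unitLawTest k ≟ 0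
  ... | yes eq = subst (λ p → Halts p k) (sym (prog-h e)) (ifzP-halts-zero unitLawTestP-computes Z-computes eq)
  ... | no  ne = subst (λ p → Halts p k) (sym (prog-h e))
                   (Equivalence.from (ifzP-halts-suc unitLawTestP-computes Z-computes ne) k∈)

  x₀-identityʳ : ∀ e a → Cong (suc n) (h e) CS (a ∙ x₀) a
  x₀-identityʳ e (var i) = base (unitLawCode (toℕ i)) (unitLawCode-∈W-h e (toℕ i) (toℕ<n i))
    (trans (decodePair-unitLawCode (toℕ i) (toℕ<n i))
           (cong (λ j → just (var j ∙ x₀ , var j)) (fromℕ<-toℕ i (toℕ<n i))))
  x₀-identityʳ e (a ∙ b) = ≈-trans (assoc a b x₀) (∙-cong ≈-refl (x₀-identityʳ e b))

  σ-cong : ∀ {e t u} → Cong n e CM t u → Cong (suc n) (h e) CS (σ t) (σ u)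
  σ-cong {e} (base k k∈ eq) = base k (∈W-h⁺ e k k∈) (trans (decodePair-σ k) (cong (map σ×σ) eq))
  σ-cong ≈-refl             = ≈-refl
  σ-cong (≈-sym c)          = ≈-sym (σ-cong c)
  σ-cong (≈-trans c d)      = ≈-trans (σ-cong c) (σ-cong d)
  σ-cong (∙-cong c d)       = ∙-cong (σ-cong c) (σ-cong d)
  σ-cong (assoc t u v)      = assoc (σ t) (σ u) (σ v)
  σ-cong (comm t u)         = comm (σ t) (σ u)
  σ-cong {e} (identʳ t)     = x₀-identityʳ e (σ t)

  ρ-cong : ∀ {e a b} → Cong (suc n) (h e) CS a b → Cong n e CM (ρ a) (ρ b)
  ρ-cong {e} (base k k∈ eq) with ∈W-h⁻ e k k∈
  ... | inj₂ k∈e = base k k∈e (decodePair-ρ k eq)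
  ... | inj₁ (i , i<1+n , refl) with ,-injective (just-injective (trans (sym eq) (decodePair-unitLawCode i i<1+n)))
  ...   | refl , refl = identʳ (ρ (var (fromℕ< i<1+n)))
  ρ-cong ≈-refl        = ≈-refl
  ρ-cong (≈-sym c)     = ≈-sym (ρ-cong c)
  ρ-cong (≈-trans c d) = ≈-trans (ρ-cong c) (ρ-cong d)
  ρ-cong (∙-cong c d)  = ∙-cong (ρ-cong c) (ρ-cong d)
  ρ-cong (assoc a b c) = assoc (ρ a) (ρ b) (ρ c)
  ρ-cong (comm a b)    = comm (ρ a) (ρ b)

  σ-conjugate-inverse : ∀ {j} (F G : Term CM n → Term CM n) → (∀ t → Cong n j CM (F (G t)) t) →
    ∀ a → Cong (suc n) (h j) CS (σ (F (ρ (σ (G (ρ a)))))) a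
  σ-conjugate-inverse F G FG≈id a =
    ≈-trans (≡⇒≈ (cong (σ ∘ F) (ρ-σ (G (ρ a))))) (≈-trans (σ-cong (FG≈id (ρ a))) (≡⇒≈ (σ-ρ a)))

  ρ-conjugate-inverse : ∀ {j} (F G : Term CS (suc n) → Term CS (suc n)) →
    (∀ a → Cong (suc n) (h j) CS (F (G a)) a) →
    ∀ t → Cong n j CM (ρ (F (σ (ρ (G (σ t)))))) t
  ρ-conjugate-inverse F G FG≈id t =
    ≈-trans (≡⇒≈ (cong (ρ ∘ F) (σ-ρ (G (σ t))))) (≈-trans (ρ-cong (FG≈id (σ t))) (≡⇒≈ (ρ-σ t)))

  iso⁺ : ∀ {e i} → Iso CM n e i → Iso CS (suc n) (h e) (h i)
  iso⁺ J = record
    { to        = σ ∘ to ∘ ρ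
    ; from      = σ ∘ from ∘ ρ
    ; to-cong   = σ-cong ∘ to-cong ∘ ρ-cong
    ; from-cong = σ-cong ∘ from-cong ∘ ρ-cong
    ; to-hom    = λ a b → σ-cong (to-hom (ρ a) (ρ b))
    ; to-unit   = tt
    ; from-to   = σ-conjugate-inverse from to from-to
    ; to-from   = σ-conjugate-inverse to from to-from
    }
    where open Iso J

  iso⁻ : ∀ {e i} → Iso CS (suc n) (h e) (h i) → Iso CM n e i
  iso⁻ {e} {i} J = record
    { to        = ρ ∘ to ∘ σ
    ; from      = ρ ∘ from ∘ σ
    ; to-cong   = ρ-cong ∘ to-cong ∘ σ-cong
    ; from-cong = ρ-cong ∘ from-cong ∘ σ-cong
    ; to-hom    = λ t u → ρ-cong (to-hom (σ t) (σ u))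
    ; to-unit   = ρ-to-x₀≈ε
    ; from-to   = ρ-conjugate-inverse from to from-to
    ; to-from   = ρ-conjugate-inverse to from to-from
    }
    where
    open Iso J
    open SetoidReasoning (≈-setoid (suc n) (h i) CS)
    to-x₀-identityˡ : ∀ a → Cong (suc n) (h i) CS (to x₀ ∙ a) a
    to-x₀-identityˡ a = begin
      to x₀ ∙ a               ≈⟨ ∙-cong ≈-refl (≈-sym (to-from a)) ⟩
      to x₀ ∙ to (from a)     ≈⟨ ≈-sym (to-hom x₀ (from a)) ⟩
      to (x₀ ∙ from a)        ≈⟨ to-cong (comm x₀ (from a)) ⟩
      to (from a ∙ x₀)        ≈⟨ to-cong (x₀-identityʳ e (from a)) ⟩
      to (from a)             ≈⟨ to-from a ⟩
      a                       ∎
    ρ-to-x₀≈ε : Cong n i CM (ρ (to x₀)) ε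
    ρ-to-x₀≈ε = ≈-trans (≈-sym (identʳ (ρ (to x₀)))) (ρ-cong (to-x₀-identityˡ x₀))

  reduction : ≅[ CM , n ] ≤c ≅[ CS , suc n ]
  reduction = h , h-computable , λ e i → mk⇔ iso⁺ iso⁻

proposition4p16 : ∀ (n : ℕ) → 2 ≤ n →
    (≅[ CS , n ] ≤c ≅[ CM , n ]) × (≅[ CM , n ] ≤c ≅[ CS , suc n ])
proposition4p16 n 2≤n =
  SemigroupsToMonoids.reduction n (≤-trans (s≤s z≤n) 2≤n) , MonoidsToSemigroups.reduction n
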